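{- Let $G$ be a connected graph such that $\overline{G}$ is connected. If $\mathrm{diam}(G) \geq 3$, then $\mathrm{m}(G\overline{G})= 2$.
   Context: All graphs are finite, simple and undirected; $\mathrm{diam}(G)$ is the diameter of $G$. The complementary prism $G\overline{G}$ of a graph $G$ is obtained from the disjoint union of $G$ and its complement $\overline{G}$ by adding the edges of the perfect matching joining each vertex $u$ of $G$ to its copy $\overline{u}$ in $\overline{G}$. A path is monophonic if it is an induced (chordless) path. For vertices $u,v$ of a graph $H$, $J_H[u,v]$ is the set of vertices of all monophonic $u,v$-paths in $H$, and for $S\subseteq V(H)$, $J_H[S]=\bigcup_{u,v\in S}J_H[u,v]$. A set $S$ is a monophonic set of $H$ if $J_H[S]=V(H)$; the monophonic number $\mathrm{m}(H)$ is the minimum cardinality of a monophonic set of $H$. -}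

module Defs where

open import Data.Nat using (ℕ; zero; suc; _≤_)
open import Data.Fin using (Fin; toℕ; fromℕ) renaming (zero to fzero)
open import Data.List using (List; length)
open import Data.List.Membership.Propositional using (_∈_)
open import Data.List.Relation.Unary.Unique.Propositional using (Unique)
open import Data.Sum using (_⊎_; inj₁; inj₂)
open import Data.Product using (Σ; ∃; ∃-syntax; _×_; _,_)
open import Data.Empty using (⊥)
open import Relation.Nullary using (¬_)
open import Relation.Binary.PropositionalEquality using (_≡_; _≢_; refl; sym)
open import Function.Bundles using (_⇔_)

record SimpleGraph (V : Set) : Set₁ where
  field
    Adj     : V → V → Set
    symm    : ∀ {u v} → Adj u v → Adj v u
    irrefl  : ∀ {u} → ¬ Adj u u
open SimpleGraph public

complement : ∀ {V} → SimpleGraph V → SimpleGraph V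
complement G = record
  { Adj    = λ u v → ¬ Adj G u v × u ≢ v
  ; symm   = λ { (na , ne) → (λ a → na (symm G a)) , (λ e → ne (sym e)) }
  ; irrefl = λ { (_ , ne) → ne refl }
  }

-- Complementary prism G Ḡ: vertices inj₁ u (copy in G) and inj₂ u (copy in Ḡ).
prismAdj : ∀ {V} → SimpleGraph V → V ⊎ V → V ⊎ V → Set
prismAdj G (inj₁ u) (inj₁ v) = Adj G u v
prismAdj G (inj₂ u) (inj₂ v) = Adj (complement G) u v
prismAdj G (inj₁ u) (inj₂ v) = u ≡ v
prismAdj G (inj₂ u) (inj₁ v) = u ≡ v

complementaryPrism : ∀ {V} → SimpleGraph V → SimpleGraph (V ⊎ V)
complementaryPrism G = record { Adj = prismAdj G ; symm = λ {x} {y} → s {x} {y} ; irrefl = λ {x} → i {x} }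
  where
    s : ∀ {x y} → prismAdj G x y → prismAdj G y x
    s {inj₁ u} {inj₁ v} a = symm G a
    s {inj₂ u} {inj₂ v} a = symm (complement G) a
    s {inj₁ u} {inj₂ v} e = sym e
    s {inj₂ u} {inj₁ v} e = sym e
    i : ∀ {x} → ¬ prismAdj G x x
    i {inj₁ u} = irrefl G
    i {inj₂ u} = irrefl (complement G)

data Walk {V : Set} (G : SimpleGraph V) : V → V → ℕ → Set where
  nil  : ∀ {u} → Walk G u u zero
  cons : ∀ {u w v k} → Adj G u w → Walk G w v k → Walk G u v (suc k)

Connected : ∀ {V} → SimpleGraph V → Set
Connected G = ∀ u v → ∃[ k ] Walk G u v k

Dist : ∀ {V} → SimpleGraph V → V → V → ℕ → Set
Dist G u v d = Walk G u v d × (∀ k → Walk G u v k → d ≤ k)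

Diam : ∀ {V} → SimpleGraph V → ℕ → Set
Diam {V} G D = (∀ u v → ∃[ d ] (Dist G u v d × d ≤ D)) × (∃[ u ] ∃[ v ] Dist G u v D)

-- Monophonic (induced) u,v-path with k edges: vertices p 0,…,p k, pairwise
-- distinct, and two vertices adjacent iff they are consecutive.
record MonoPath {V : Set} (H : SimpleGraph V) (u v : V) : Set where
  field
    len    : ℕ
    vert   : Fin (suc len) → V
    start  : vert fzero ≡ u
    end    : vert (fromℕ len) ≡ v
    inj    : ∀ i j → vert i ≡ vert j → i ≡ j
    induced : ∀ i j → Adj H (vert i) (vert j) ⇔ (toℕ j ≡ suc (toℕ i) ⊎ toℕ i ≡ suc (toℕ j))

InInterval : ∀ {V} → SimpleGraph V → V → V → V → Set
InInterval H u v w = Σ (MonoPath H u v) λ P → ∃[ i ] MonoPath.vert P i ≡ w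

IsMonophonicSet : ∀ {V} → SimpleGraph V → List V → Set
IsMonophonicSet H S = ∀ w → ∃[ u ] ∃[ v ] (u ∈ S × v ∈ S × InInterval H u v w)

-- m(H) = k : minimum cardinality of a monophonic set (sets = duplicate-free lists).
MonophonicNumber : ∀ {V} → SimpleGraph V → ℕ → Set
MonophonicNumber H k =
  (∃[ S ] (Unique S × length S ≡ k × IsMonophonicSet H S)) ×
  (∀ S → Unique S → IsMonophonicSet H S → k ≤ length S)

-- Take u, v with d(u,v) = diam G ≥ 3.  Every x ∈ V(G) satisfies, say,
-- d(x,v) ≤ d(x,u).  A geodesic x = z₀, …, zₐ = v then stays at distance ≥ 2
-- from u: d(zᵢ,v) = a − i ≤ d(x,u) − i ≤ d(zᵢ,u), and the two add up to at
-- least d(u,v) ≥ 3.  Hence u, ū, x̄, z₀, …, zₐ is an induced path of the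
-- prism through both x and x̄, so {u, v} is a monophonic set.  No single
-- vertex s is one, since J[s,s] = {s}.
module Submission where

open import Defs
open import Data.Nat using (ℕ; zero; suc; _≤_; _≰_; _+_; z≤n; s≤s)
open import Data.Nat.Properties
open import Data.Fin using (Fin; toℕ; fromℕ) renaming (zero to fzero; suc to fsuc)
open import Data.Vec.Functional using () renaming (_∷_ to _∷ᵛ_)
open import Data.Sum using (_⊎_; inj₁; inj₂; reduce) renaming (map to map⊎)
open import Data.Sum.Properties using (inj₁-injective; inj₂-injective)
open import Data.Product using (∃-syntax; _×_; _,_; proj₁; proj₂)
open import Data.List using ([]; _∷_; length)
open import Data.List.Relation.Unary.Any using (here; there)
open import Data.List.Relation.Unary.All using ([]; _∷_)
open import Data.List.Relation.Unary.AllPairs using ([]; _∷_)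
open import Data.Empty using (⊥-elim)
open import Relation.Nullary using (¬_; yes; no; contradiction)
open import Relation.Binary.PropositionalEquality
open import Function using (_∘_)
open import Function.Bundles using (_⇔_; mk⇔; Equivalence)

3≤n+n⇒2≤n : ∀ {n} → 3 ≤ n + n → 2 ≤ n
3≤n+n⇒2≤n {zero} ()
3≤n+n⇒2≤n {suc zero} (s≤s (s≤s ()))
3≤n+n⇒2≤n {suc (suc n)} _ = s≤s (s≤s z≤n)

Dist-unique : ∀ {V} {G : SimpleGraph V} {x y d d′} → Dist G x y d → Dist G x y d′ → d ≡ d′
Dist-unique (p , p-min) (q , q-min) = ≤-antisym (p-min _ q) (q-min _ p)

module Walks {V : Set} (G : SimpleGraph V) where

  _++ʷ_ : ∀ {x y z m k} → Walk G x y m → Walk G y z k → Walk G x z (m + k)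
  nil ++ʷ q = q
  cons a p ++ʷ q = cons a (p ++ʷ q)

  reverseʷ : ∀ {x y m} → Walk G x y m → Walk G y x m
  reverseʷ nil = nil
  reverseʷ {m = suc m} (cons a p) =
    subst (Walk G _ _) (+-comm m 1) (reverseʷ p ++ʷ cons (symm G a) nil)

  walk₀⇒≡ : ∀ {x y} → Walk G x y 0 → x ≡ y
  walk₀⇒≡ nil = refl

module MonoPaths {X : Set} (H : SimpleGraph X) where
  open MonoPath

  trivial : ∀ x → MonoPath H x x
  trivial x = record
    { len = 0 ; vert = λ _ → x ; start = refl ; end = refl
    ; inj = λ { fzero fzero _ → refl }
    ; induced = λ { fzero fzero → mk⇔ (⊥-elim ∘ irrefl H) λ { (inj₁ ()) ; (inj₂ ()) } }
    }

  start∉tail : ∀ {x t} (P : MonoPath H x t) i → vert P (fsuc i) ≢ x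
  start∉tail P i e with inj P fzero (fsuc i) (trans (start P) (sym e))
  ... | ()

  prepend : ∀ {x y t} (P : MonoPath H y t) → Adj H x y →
    (∀ i → vert P i ≢ x) → (∀ i → ¬ Adj H x (vert P (fsuc i))) → MonoPath H x t
  prepend {x} P x~y x∉P x≁tail = record
    { len = suc (len P) ; vert = x ∷ᵛ vert P ; start = refl ; end = end P
    ; inj = injective ; induced = induced′ }
    where
      injective : ∀ i j → (x ∷ᵛ vert P) i ≡ (x ∷ᵛ vert P) j → i ≡ j
      injective fzero fzero _ = refl
      injective fzero (fsuc j) e = contradiction (sym e) (x∉P j)
      injective (fsuc i) fzero e = contradiction e (x∉P i)
      injective (fsuc i) (fsuc j) e = cong fsuc (inj P i j e)

      adj-head : ∀ j → Adj H x (vert P j) → toℕ j ≡ 0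
      adj-head fzero _ = refl
      adj-head (fsuc j) a = contradiction a (x≁tail j)

      head-adj : ∀ j → toℕ j ≡ 0 → Adj H x (vert P j)
      head-adj fzero _ = subst (Adj H x) (sym (start P)) x~y
      head-adj (fsuc j) ()

      induced′ : ∀ i j → Adj H ((x ∷ᵛ vert P) i) ((x ∷ᵛ vert P) j) ⇔
                         (toℕ j ≡ suc (toℕ i) ⊎ toℕ i ≡ suc (toℕ j))
      induced′ fzero fzero = mk⇔ (λ a → contradiction a (irrefl H)) λ { (inj₁ ()) ; (inj₂ ()) }
      induced′ fzero (fsuc j) =
        mk⇔ (λ a → inj₁ (cong suc (adj-head j a)))
            λ { (inj₁ e) → head-adj j (suc-injective e) ; (inj₂ ()) }
      induced′ (fsuc i) fzero =
        mk⇔ (λ a → inj₂ (cong suc (adj-head i (symm H a))))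
            λ { (inj₁ ()) ; (inj₂ e) → symm H (head-adj i (suc-injective e)) }
      induced′ (fsuc i) (fsuc j) = mk⇔
        (map⊎ (cong suc) (cong suc) ∘ Equivalence.to (induced P i j))
        (Equivalence.from (induced P i j) ∘ map⊎ suc-injective suc-injective)

  inInterval-self : ∀ {s w} → InInterval H s s w → w ≡ s
  inInterval-self {s} (P , i , eq) =
    trans (sym eq) (trans (cong (vert P) (only-fzero (len P) i first≡last)) (start P))
    where
      first≡last : fzero ≡ fromℕ (len P)
      first≡last = inj P fzero (fromℕ (len P)) (trans (start P) (sym (end P)))
      only-fzero : ∀ L (i : Fin (suc L)) → fzero ≡ fromℕ L → i ≡ fzero
      only-fzero zero fzero _ = refl
      only-fzero (suc L) i ()

monophonicSet-size : ∀ {X} (H : SimpleGraph X) {a b : X} → a ≢ b →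
  ∀ S → IsMonophonicSet H S → 2 ≤ length S
monophonicSet-size H {a} a≢b [] mono with mono a
... | _ , _ , () , _
monophonicSet-size H {a} {b} a≢b (s ∷ []) mono with mono a | mono b
... | _ , _ , here refl , here refl , Ia | _ , _ , here refl , here refl , Ib =
  ⊥-elim (a≢b (trans (inInterval-self Ia) (sym (inInterval-self Ib))))
  where open MonoPaths H
monophonicSet-size H a≢b (s ∷ s′ ∷ S) _ = s≤s (s≤s z≤n)

module Prism {V : Set} (G : SimpleGraph V) where
  open MonoPath
  open MonoPaths (complementaryPrism G)

  lift₁ : ∀ {x t} → MonoPath G x t → MonoPath (complementaryPrism G) (inj₁ x) (inj₁ t)
  lift₁ P = record
    { len = len P ; vert = inj₁ ∘ vert P ; start = cong inj₁ (start P) ; end = cong inj₁ (end P)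
    ; inj = λ i j → inj P i j ∘ inj₁-injective ; induced = induced P }

  detour : ∀ {u x v} (P : MonoPath G x v) →
    (∀ i → u ≢ vert P i) → (∀ i → ¬ Adj G u (vert P i)) →
    MonoPath (complementaryPrism G) (inj₁ u) (inj₁ v)
  detour {u} {x} {v} P u∉P u≁P = prepend ū⋯v refl u∉ū⋯v u≁x̄⋯v
    where
      u≢x : u ≢ x
      u≢x = subst (u ≢_) (start P) (u∉P fzero)

      u≁x : ¬ Adj G u x
      u≁x = subst (λ y → ¬ Adj G u y) (start P) (u≁P fzero)

      x̄⋯v : MonoPath (complementaryPrism G) (inj₂ x) (inj₁ v)
      x̄⋯v = prepend (lift₁ P) refl (λ _ ()) (λ i e → MonoPaths.start∉tail G P i (sym e))

      ū⋯v : MonoPath (complementaryPrism G) (inj₂ u) (inj₁ v)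
      ū⋯v = prepend x̄⋯v (u≁x , u≢x)
        (λ { fzero e → u≢x (sym (inj₂-injective e)) ; (fsuc i) () })
        u∉P

      u∉ū⋯v : ∀ i → vert ū⋯v i ≢ inj₁ u
      u∉ū⋯v fzero ()
      u∉ū⋯v (fsuc fzero) ()
      u∉ū⋯v (fsuc (fsuc i)) e = u∉P i (sym (inj₁-injective e))

      u≁x̄⋯v : ∀ i → ¬ Adj (complementaryPrism G) (inj₁ u) (vert x̄⋯v i)
      u≁x̄⋯v fzero = u≢x
      u≁x̄⋯v (fsuc i) = u≁P i

  detour-covers : ∀ {u x v} (P : MonoPath G x v)
    (u∉P : ∀ i → u ≢ vert P i) (u≁P : ∀ i → ¬ Adj G u (vert P i)) →
    ∀ w → reduce w ≡ x → ∃[ i ] vert (detour {u} P u∉P u≁P) i ≡ w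
  detour-covers P _ _ (inj₁ _) refl = fsuc (fsuc (fsuc fzero)) , cong inj₁ (start P)
  detour-covers P _ _ (inj₂ _) refl = fsuc (fsuc fzero) , refl

module Distance {V : Set} (G : SimpleGraph V)
  (dist : V → V → ℕ) (isDist : ∀ x y → Dist G x y (dist x y)) where
  open Walks G
  open MonoPaths G
  open MonoPath

  shortest : ∀ {x y k} → Walk G x y k → dist x y ≤ k
  shortest = proj₂ (isDist _ _) _

  geodesicWalk : ∀ x y → Walk G x y (dist x y)
  geodesicWalk x y = proj₁ (isDist x y)

  dist-refl : ∀ x → dist x x ≡ 0
  dist-refl x = n≤0⇒n≡0 (shortest nil)

  dist≡0⇒≡ : ∀ {x y} → dist x y ≡ 0 → x ≡ y
  dist≡0⇒≡ {x} {y} e = walk₀⇒≡ (subst (Walk G x y) e (geodesicWalk x y))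

  dist-sym : ∀ x y → dist x y ≡ dist y x
  dist-sym x y = ≤-antisym (shortest (reverseʷ (geodesicWalk y x)))
                           (shortest (reverseʷ (geodesicWalk x y)))

  dist-triangle : ∀ x y z → dist x z ≤ dist x y + dist y z
  dist-triangle x y z = shortest (geodesicWalk x y ++ʷ geodesicWalk y z)

  adj⇒dist≤suc : ∀ {x y} z → Adj G x y → dist x z ≤ suc (dist y z)
  adj⇒dist≤suc z a = shortest (cons a (geodesicWalk _ z))

  2≤dist⇒≢ : ∀ {x y} → 2 ≤ dist x y → x ≢ y
  2≤dist⇒≢ {x} h refl with subst (2 ≤_) (dist-refl x) h
  ... | ()

  2≤dist⇒¬Adj : ∀ {x y} → 2 ≤ dist x y → ¬ Adj G x y
  2≤dist⇒¬Adj h a = <⇒≱ h (shortest (cons a nil))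

  step-toward : ∀ {x t k} → dist x t ≡ suc k → ∃[ y ] (Adj G x y × dist y t ≡ k)
  step-toward {x} {t} e with subst (Walk G x t) e (geodesicWalk x t)
  ... | cons {w = y} a r =
    y , a , ≤-antisym (shortest r) (≤-pred (subst (_≤ suc (dist y t)) e (adj⇒dist≤suc t a)))

  record Geodesic (x t : V) : Set where
    field
      path            : MonoPath G x t
      dist-to-end     : ∀ i → dist (vert path i) t + toℕ i ≡ dist x t
      dist-from-start : ∀ i → dist x (vert path i) ≤ toℕ i

  geodesic-refl : ∀ x → Geodesic x x
  geodesic-refl x = record
    { path = trivial x
    ; dist-to-end = λ { fzero → +-identityʳ (dist x x) }
    ; dist-from-start = λ { fzero → ≤-reflexive (dist-refl x) }
    }

  geodesic-extend : ∀ {x y t} → Adj G x y → dist x t ≡ suc (dist y t) → Geodesic y t → Geodesic x t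
  geodesic-extend {x} {y} {t} x~y e Q = record
    { path = prepend (path Q) x~y x∉Q x≁tail
    ; dist-to-end = to-end
    ; dist-from-start = from-start
    }
    where
      open Geodesic
      closer : ∀ i → dist (vert (path Q) i) t + toℕ i ≤ dist y t
      closer i = ≤-reflexive (dist-to-end Q i)

      not-closer : dist x t ≰ dist y t
      not-closer h = n≮n _ (subst (_≤ dist y t) e h)

      x∉Q : ∀ i → vert (path Q) i ≢ x
      x∉Q i refl = not-closer (≤-trans (m≤m+n _ _) (closer i))

      x≁tail : ∀ i → ¬ Adj G x (vert (path Q) (fsuc i))
      x≁tail i a = not-closer (begin
        dist x t                                         ≤⟨ adj⇒dist≤suc t a ⟩
        suc (dist (vert (path Q) (fsuc i)) t)            ≤⟨ s≤s (m≤m+n _ _) ⟩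
        suc (dist (vert (path Q) (fsuc i)) t + toℕ i)    ≡⟨ sym (+-suc _ _) ⟩
        dist (vert (path Q) (fsuc i)) t + suc (toℕ i)    ≤⟨ closer (fsuc i) ⟩
        dist y t                                         ∎)
        where open ≤-Reasoning

      to-end : ∀ i → dist ((x ∷ᵛ vert (path Q)) i) t + toℕ i ≡ dist x t
      to-end fzero = +-identityʳ _
      to-end (fsuc i) = begin
        dist (vert (path Q) i) t + suc (toℕ i)    ≡⟨ +-suc _ _ ⟩
        suc (dist (vert (path Q) i) t + toℕ i)    ≡⟨ cong suc (dist-to-end Q i) ⟩
        suc (dist y t)                            ≡⟨ sym e ⟩
        dist x t                                  ∎
        where open ≡-Reasoning

      from-start : ∀ i → dist x ((x ∷ᵛ vert (path Q)) i) ≤ toℕ i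
      from-start fzero = ≤-reflexive (dist-refl x)
      from-start (fsuc i) = ≤-trans (adj⇒dist≤suc _ x~y) (s≤s (dist-from-start Q i))

  geodesic : ∀ {x t} k → dist x t ≡ k → Geodesic x t
  geodesic {x} zero e = subst (Geodesic x) (dist≡0⇒≡ e) (geodesic-refl x)
  geodesic (suc k) e with step-toward e
  ... | y , x~y , dy = geodesic-extend x~y (trans e (cong suc (sym dy))) (geodesic k dy)

  geodesic-avoids : ∀ {u v x} → 3 ≤ dist u v → dist x v ≤ dist x u →
    (Z : Geodesic x v) → ∀ i → 2 ≤ dist u (vert (Geodesic.path Z) i)
  geodesic-avoids {u} {v} {x} 3≤uv x-nearer-v Z i = 3≤n+n⇒2≤n (begin
    3                      ≤⟨ 3≤uv ⟩
    dist u v               ≤⟨ dist-triangle u z v ⟩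
    dist u z + dist z v    ≤⟨ +-monoʳ-≤ (dist u z) z-nearer-v ⟩
    dist u z + dist u z    ∎)
    where
      open ≤-Reasoning
      open Geodesic Z
      z : V
      z = vert path i

      z-nearer-v : dist z v ≤ dist u z
      z-nearer-v = +-cancelʳ-≤ (toℕ i) _ _ (begin
        dist z v + toℕ i       ≡⟨ dist-to-end i ⟩
        dist x v               ≤⟨ x-nearer-v ⟩
        dist x u               ≤⟨ dist-triangle x z u ⟩
        dist x z + dist z u    ≤⟨ +-mono-≤ (dist-from-start i) (≤-reflexive (dist-sym z u)) ⟩
        toℕ i + dist u z       ≡⟨ +-comm (toℕ i) _ ⟩
        dist u z + toℕ i       ∎)

  open Prism G

  diametral-interval : ∀ {u v} → 3 ≤ dist u v →
    ∀ w → dist (reduce w) v ≤ dist (reduce w) u → InInterval (complementaryPrism G) (inj₁ u) (inj₁ v) w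
  diametral-interval {u} {v} 3≤uv w nearer-v =
    detour (path Z) u∉Z u≁Z , detour-covers (path Z) u∉Z u≁Z w refl
    where
      open Geodesic

      Z : Geodesic (reduce w) v
      Z = geodesic _ refl

      far : ∀ i → 2 ≤ dist u (vert (path Z) i)
      far = geodesic-avoids 3≤uv nearer-v Z

      u∉Z : ∀ i → u ≢ vert (path Z) i
      u∉Z = 2≤dist⇒≢ ∘ far

      u≁Z : ∀ i → ¬ Adj G u (vert (path Z) i)
      u≁Z = 2≤dist⇒¬Adj ∘ far

  diametral-pair-monophonic : ∀ {u v} → 3 ≤ dist u v →
    IsMonophonicSet (complementaryPrism G) (inj₁ u ∷ inj₁ v ∷ [])
  diametral-pair-monophonic {u} {v} 3≤uv w with dist (reduce w) v ≤? dist (reduce w) u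
  ... | yes nearer-v =
    inj₁ u , inj₁ v , here refl , there (here refl) , diametral-interval 3≤uv w nearer-v
  ... | no nearer-u =
    inj₁ v , inj₁ u , there (here refl) , here refl ,
    diametral-interval (subst (3 ≤_) (dist-sym u v) 3≤uv) w (≰⇒≥ nearer-u)

-- Connectivity of G is contained in Diam G D.
lemma4p2 : (n : ℕ) (G : SimpleGraph (Fin n)) →
    Connected G → Connected (complement G) →
    (∃[ D ] (Diam G D × 3 ≤ D)) →
    MonophonicNumber (complementaryPrism G) 2
lemma4p2 n G _ _ (D , (distances , u , v , diametral) , 3≤D) =
  (inj₁ u ∷ inj₁ v ∷ [] , ((u≢v ∘ inj₁-injective) ∷ []) ∷ [] ∷ [] , refl ,
   diametral-pair-monophonic 3≤uv) ,
  λ S _ → monophonicSet-size (complementaryPrism G) {inj₁ u} {inj₂ u} (λ ()) S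
  where
    dist : Fin n → Fin n → ℕ
    dist x y = proj₁ (distances x y)

    isDist : ∀ x y → Dist G x y (dist x y)
    isDist x y = proj₁ (proj₂ (distances x y))

    open Distance G dist isDist

    3≤uv : 3 ≤ dist u v
    3≤uv = subst (3 ≤_) (Dist-unique diametral (isDist u v)) 3≤D

    u≢v : u ≢ v
    u≢v = 2≤dist⇒≢ (≤-trans (n≤1+n 2) 3≤uv)
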